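{- Let $j$ be an odd integer and $q\ge 3$. Then, as polynomials in $x$, $$\prod_{i=0}^{2^q-1}(ix-i+j)\equiv x^{2^{q-1}-2}\Big[2^{q-1}(x^4+x^3+x+1)+x^2\Big]\pmod{2^q}.$$ -}

module Defs where

open import Data.Nat as ℕ using (ℕ; zero; suc)
open import Data.Integer using (ℤ; +_; _+_; _*_; _-_)
open import Data.Integer.Divisibility using (_∣_)
open import Data.List using (List; []; _∷_; replicate; _++_; map; foldr; upTo)

-- Polynomials over ℤ in one variable x, as coefficient lists,
-- lowest degree first:  a₀ ∷ a₁ ∷ … ∷ aₙ ∷ []  represents  a₀ + a₁ x + … + aₙ xⁿ.
Poly : Set
Poly = List ℤ

coeff : Poly → ℕ → ℤ
coeff []       _       = + 0
coeff (a ∷ p)  zero    = a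
coeff (a ∷ p)  (suc k) = coeff p k

infixl 6 _+ₚ_
infixl 7 _*ₚ_ _·ₚ_

_+ₚ_ : Poly → Poly → Poly
[]      +ₚ q       = q
(a ∷ p) +ₚ []      = a ∷ p
(a ∷ p) +ₚ (b ∷ q) = (a + b) ∷ (p +ₚ q)

_·ₚ_ : ℤ → Poly → Poly
c ·ₚ p = map (c *_) p

_*ₚ_ : Poly → Poly → Poly
[]      *ₚ q = []
(a ∷ p) *ₚ q = (a ·ₚ q) +ₚ (+ 0 ∷ (p *ₚ q))

mono : ℤ → ℕ → Poly
mono c k = replicate k (+ 0) ++ (c ∷ [])

prodₚ : List Poly → Poly
prodₚ = foldr _*ₚ_ (mono (+ 1) 0)

_≡ₚ_mod_ : Poly → Poly → ℕ → Set
p ≡ₚ r mod m = ∀ k → (+ m) ∣ (coeff p k - coeff r k)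

linFactor : ℤ → ℕ → Poly
linFactor j i = (j - + i) ∷ (+ i) ∷ []

lhsPoly : ℤ → ℕ → Poly
lhsPoly j q = prodₚ (map (linFactor j) (upTo (2 ℕ.^ q)))

rhsPoly : ℕ → Poly
rhsPoly q = mono (+ 1) (2 ℕ.^ (q ℕ.∸ 1) ℕ.∸ 2)
  *ₚ ((+ (2 ℕ.^ (q ℕ.∸ 1))) ·ₚ (mono (+ 1) 4 +ₚ mono (+ 1) 3 +ₚ mono (+ 1) 1 +ₚ mono (+ 1) 0)
      +ₚ mono (+ 1) 2)

{-# OPTIONS --safe #-}
module Submission where

-- Write Fₘ = ∏_{i<2^m} (ix − i + j) and R_q for the right-hand side. The factor for 2^m + i is the
-- factor for i plus 2^m (x − 1), so to first order the upper half of F_{m+1} is Fₘ + 2^m (x − 1) ∂Fₘ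
-- modulo 2^{2m}, where ∂ sums the products that omit one factor. For m ≥ 2 the two halves of Fₘ agree
-- mod 2, which makes ∂Fₘ even, hence F_{m+1} ≡ Fₘ² (mod 2^{m+1}). Squaring turns a congruence mod 2h
-- into one mod 4h, and R_q² ≡ R_{q+1} (mod 2^{q+1}) for q ≥ 3, so induction on q starting at q = 3
-- proves the theorem. For q = 3 the same first-order expansion, now in j − 1, gives
-- F₂ ≡ x(2x − 1)(3x − 2) (mod 4), and squaring this polynomial gives R₃ modulo 8.

open import Defs
open import Data.Nat using (ℕ; _≤_; _^_)
open import Data.Integer using (ℤ; +_)
open import Data.Integer.Divisibility using (_∣_)
open import Relation.Nullary using (¬_)

open import Algebra.Bundles using (CommutativeRing; CommutativeMonoid)
open import Data.Empty using (⊥-elim)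
open import Data.Integer using (-[1+_]; -1ℤ; 1ℤ)
import Data.Integer.DivMod as ℤ
open import Data.Integer.Divisibility.Signed using (divides; ∣⇒∣ᵤ)
import Data.Integer.Properties as ℤ
open import Data.Integer.Tactic.RingSolver using (solve-∀)
open import Data.List using (List; []; _∷_; _++_; map; foldr; upTo; applyUpTo)
import Data.List.Properties as List
open import Data.Nat using (zero; suc; _∸_; s≤s; z≤n)
import Data.Nat as ℕ
import Data.Nat.Properties as ℕ
open import Data.Product using (∃; _,_)
open import Function using (_∘_)
open import Level using (_⊔_)
open import Relation.Binary.Bundles using (Setoid)
open import Relation.Binary.PropositionalEquality
  using (_≡_; refl; sym; trans; cong; cong₂; subst; module ≡-Reasoning)
import Relation.Binary.Reasoning.Setoid as SetoidReasoning
open import Relation.Binary.Structures using (IsEquivalence)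

module RingCongruence {c ℓ} (R : CommutativeRing c ℓ) where

  open CommutativeRing R renaming (refl to ≈-refl; sym to ≈-sym; trans to ≈-trans)
  open SetoidReasoning setoid
  open import Algebra.Solver.Ring.NaturalCoefficients.Default commutativeSemiring

  infix 4 _≈_mod_

  record _≈_mod_ (a b m : Carrier) : Set (c ⊔ ℓ) where
    constructor witness
    field
      quotient : Carrier
      eq       : a ≈ b + m * quotient

  two : Carrier
  two = 1# + 1#

  private variable
    a b a′ b′ d m n : Carrier

  ≈⇒≈-mod : a ≈ b → a ≈ b mod m
  ≈⇒≈-mod {a} {b} {m} a≈b = witness 0# (begin
    a            ≈⟨ a≈b ⟩
    b            ≈⟨ +-identityʳ b ⟨
    b + 0#       ≈⟨ +-congˡ (zeroʳ m) ⟨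
    b + m * 0#   ∎)

  ≈-mod-refl : a ≈ a mod m
  ≈-mod-refl = ≈⇒≈-mod ≈-refl

  ≈-mod-trans : a ≈ b mod m → b ≈ d mod m → a ≈ d mod m
  ≈-mod-trans {a} {b} {m} {d} (witness s a≈) (witness t b≈) = witness (t + s) (begin
    a                  ≈⟨ a≈ ⟩
    b + m * s          ≈⟨ +-congʳ b≈ ⟩
    d + m * t + m * s  ≈⟨ solve 4 (λ d m s t → d :+ m :* t :+ m :* s := d :+ m :* (t :+ s)) ≈-refl d m s t ⟩
    d + m * (t + s)    ∎)

  +-cong-mod : a ≈ b mod m → a′ ≈ b′ mod m → a + a′ ≈ b + b′ mod m
  +-cong-mod {a} {b} {m} {a′} {b′} (witness s a≈) (witness s′ a′≈) = witness (s + s′) (begin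
    a + a′                       ≈⟨ +-cong a≈ a′≈ ⟩
    (b + m * s) + (b′ + m * s′)
      ≈⟨ solve 5 (λ b b′ m s s′ → (b :+ m :* s) :+ (b′ :+ m :* s′) := b :+ b′ :+ m :* (s :+ s′)) ≈-refl b b′ m s s′ ⟩
    b + b′ + m * (s + s′)        ∎)

  *-cong-mod : a ≈ b mod m → a′ ≈ b′ mod m → a * a′ ≈ b * b′ mod m
  *-cong-mod {a} {b} {m} {a′} {b′} (witness s a≈) (witness s′ a′≈) =
    witness (s * b′ + b * s′ + m * s * s′) (begin
      a * a′                                       ≈⟨ *-cong a≈ a′≈ ⟩
      (b + m * s) * (b′ + m * s′)
        ≈⟨ solve 5 (λ b b′ m s s′ → (b :+ m :* s) :* (b′ :+ m :* s′)
                                 := b :* b′ :+ m :* (s :* b′ :+ b :* s′ :+ m :* s :* s′)) ≈-refl b b′ m s s′ ⟩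
      b * b′ + m * (s * b′ + b * s′ + m * s * s′)  ∎)

  *-congˡ-mod : ∀ d → a ≈ b mod m → d * a ≈ d * b mod m
  *-congˡ-mod d = *-cong-mod ≈-mod-refl

  mod-*ʳ : ∀ n → a ≈ b mod (m * n) → a ≈ b mod m
  mod-*ʳ {a} {b} {m} n (witness s a≈) = witness (n * s) (≈-trans a≈ (+-congˡ (*-assoc m n s)))

  mod-resp : m ≈ n → a ≈ b mod m → a ≈ b mod n
  mod-resp m≈n (witness s a≈) = witness s (≈-trans a≈ (+-congˡ (*-congʳ m≈n)))

  square-mod : ∀ m → a ≈ b mod (two * m) → a * a ≈ b * b mod (two * (two * m))
  square-mod {a} {b} m (witness s a≈) = witness (b * s + m * s * s) (begin
    a * a                                          ≈⟨ *-cong a≈ a≈ ⟩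
    (b + two * m * s) * (b + two * m * s)
      ≈⟨ solve 3 (λ b m s → (b :+ con 2 :* m :* s) :* (b :+ con 2 :* m :* s)
                          := b :* b :+ con 2 :* (con 2 :* m) :* (b :* s :+ m :* s :* s)) ≈-refl b m s ⟩
    b * b + two * (two * m) * (b * s + m * s * s)  ∎)

  product : List Carrier → Carrier
  product = foldr _*_ 1#

  -- The derivative at t = 0 of the product of the (a + t), a ∈ as.
  ∂product : List Carrier → Carrier
  ∂product []       = 0#
  ∂product (a ∷ as) = product as + a * ∂product as

  product-++ : ∀ as bs → product (as ++ bs) ≈ product as * product bs
  product-++ []       bs = ≈-sym (*-identityˡ (product bs))
  product-++ (a ∷ as) bs = ≈-trans (*-congˡ (product-++ as bs)) (≈-sym (*-assoc a (product as) (product bs)))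

  ∂product-++ : ∀ as bs → ∂product (as ++ bs) ≈ ∂product as * product bs + product as * ∂product bs
  ∂product-++ []       bs = solve 2 (λ P D → D := con 0 :* P :+ con 1 :* D) ≈-refl (product bs) (∂product bs)
  ∂product-++ (a ∷ as) bs = begin
    product (as ++ bs) + a * ∂product (as ++ bs)  ≈⟨ +-cong (product-++ as bs) (*-congˡ (∂product-++ as bs)) ⟩
    P * Q + a * (D * Q + P * E)
      ≈⟨ solve 5 (λ a P Q D E → P :* Q :+ a :* (D :* Q :+ P :* E) := (P :+ a :* D) :* Q :+ (a :* P) :* E)
                 ≈-refl a P Q D E ⟩
    (P + a * D) * Q + (a * P) * E                 ∎
    where P = product as; Q = product bs; D = ∂product as; E = ∂product bs

  module _ {a} {A : Set a} (f g : A → Carrier) where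

    product-cong-mod : (∀ x → g x ≈ f x mod m) → ∀ xs → product (map g xs) ≈ product (map f xs) mod m
    product-cong-mod g≈f []       = ≈-mod-refl
    product-cong-mod g≈f (x ∷ xs) = *-cong-mod (g≈f x) (product-cong-mod g≈f xs)

    ∂product-cong-mod : (∀ x → g x ≈ f x mod m) → ∀ xs → ∂product (map g xs) ≈ ∂product (map f xs) mod m
    ∂product-cong-mod g≈f []       = ≈-mod-refl
    ∂product-cong-mod g≈f (x ∷ xs) =
      +-cong-mod (product-cong-mod g≈f xs) (*-cong-mod (g≈f x) (∂product-cong-mod g≈f xs))

    ∂product-doubled : (∀ x → g x ≈ f x mod two) → ∀ xs → ∂product (map f xs ++ map g xs) ≈ 0# mod two
    ∂product-doubled g≈f xs = ≈-mod-trans (≈⇒≈-mod (∂product-++ (map f xs) (map g xs)))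
      (≈-mod-trans (+-cong-mod (*-congˡ-mod D (product-cong-mod g≈f xs)) (*-congˡ-mod P (∂product-cong-mod g≈f xs)))
        (witness (P * D) (solve 2 (λ P D → D :* P :+ P :* D := con 0 :+ con 2 :* (P :* D)) ≈-refl P D)))
      where P = product (map f xs); D = ∂product (map f xs)

    product-first-order : ∀ e → (∀ x → g x ≈ f x + e) → ∀ xs →
      product (map g xs) ≈ product (map f xs) + e * ∂product (map f xs) mod (e * e)
    product-first-order e g≈f+e []       = ≈⇒≈-mod (solve 1 (λ e → con 1 := con 1 :+ e :* con 0) ≈-refl e)
    product-first-order e g≈f+e (x ∷ xs) = ≈-mod-trans
      (*-cong-mod (≈⇒≈-mod (g≈f+e x)) (product-first-order e g≈f+e xs))
      (witness D (solve 4 (λ F e P D → (F :+ e) :* (P :+ e :* D) := F :* P :+ e :* (P :+ F :* D) :+ e :* e :* D)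
                          ≈-refl (f x) e P D))
      where P = product (map f xs); D = ∂product (map f xs)

    product-even-shift : ∀ d → (∀ x → g x ≈ f x + two * d) → ∀ xs → ∂product (map f xs) ≈ 0# mod two →
      product (map g xs) ≈ product (map f xs) mod (two * two * d)
    product-even-shift d g≈f+2d xs (witness u D≈2u) with product-first-order (two * d) g≈f+2d xs
    ... | witness s G≈ = witness (u + d * s) (begin
      product (map g xs)                                      ≈⟨ G≈ ⟩
      P + two * d * D + two * d * (two * d) * s               ≈⟨ +-congʳ (+-congˡ (*-congˡ D≈2u)) ⟩
      P + two * d * (0# + two * u) + two * d * (two * d) * s
        ≈⟨ solve 4 (λ P d u s → P :+ con 2 :* d :* (con 0 :+ con 2 :* u) :+ con 2 :* d :* (con 2 :* d) :* s
                              := P :+ con 2 :* con 2 :* d :* (u :+ d :* s)) ≈-refl P d u s ⟩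
      P + two * two * d * (u + d * s)                         ∎)
      where P = product (map f xs); D = ∂product (map f xs)

-- Imported only here, since inside RingCongruence these operators are those of the ring.
open import Data.Integer using (_+_; _*_; _-_; -_)

applyUpTo-+ : ∀ {a} {A : Set a} (f : ℕ → A) m n → applyUpTo f (m ℕ.+ n) ≡ applyUpTo f m ++ applyUpTo (f ∘ (m ℕ.+_)) n
applyUpTo-+ f zero    n = refl
applyUpTo-+ f (suc m) n = cong (f 0 ∷_) (applyUpTo-+ (f ∘ suc) m n)

map-upTo-2^suc : ∀ {a} {A : Set a} (f : ℕ → A) m →
  map f (upTo (2 ^ suc m)) ≡ map f (upTo (2 ^ m)) ++ map (f ∘ (2 ^ m ℕ.+_)) (upTo (2 ^ m))
map-upTo-2^suc f m = begin
  map f (upTo (2 ^ suc m))                         ≡⟨ List.map-upTo f (2 ^ suc m) ⟩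
  applyUpTo f (n ℕ.+ (n ℕ.+ 0))                    ≡⟨ cong (λ k → applyUpTo f (n ℕ.+ k)) (ℕ.+-identityʳ n) ⟩
  applyUpTo f (n ℕ.+ n)                            ≡⟨ applyUpTo-+ f n n ⟩
  applyUpTo f n ++ applyUpTo (f ∘ (n ℕ.+_)) n      ≡⟨ cong₂ _++_ (List.map-upTo f n) (List.map-upTo (f ∘ (n ℕ.+_)) n) ⟨
  map f (upTo n) ++ map (f ∘ (n ℕ.+_)) (upTo n)    ∎
  where
  n = 2 ^ m
  open ≡-Reasoning

2*n∸2 : ∀ n → 2 ≤ n → 2 ℕ.* n ∸ 2 ≡ (n ∸ 2) ℕ.+ ((n ∸ 2) ℕ.+ 2)
2*n∸2 (suc (suc n)) (s≤s (s≤s _)) = cong (n ℕ.+_) (trans (ℕ.+-identityʳ (2 ℕ.+ n)) (ℕ.+-comm 2 n))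

2^[2+r]² : ∀ r → 2 ^ (2 ℕ.+ r) ℕ.* 2 ^ (2 ℕ.+ r) ≡ 2 ^ (4 ℕ.+ r) ℕ.* 2 ^ r
2^[2+r]² r = begin
  2 ^ (2 ℕ.+ r) ℕ.* 2 ^ (2 ℕ.+ r)  ≡⟨ ℕ.^-distribˡ-+-* 2 (2 ℕ.+ r) (2 ℕ.+ r) ⟨
  2 ^ (2 ℕ.+ r ℕ.+ (2 ℕ.+ r))      ≡⟨ cong (λ k → 2 ^ (2 ℕ.+ k)) (trans (ℕ.+-suc r (suc r)) (cong suc (ℕ.+-suc r r))) ⟩
  2 ^ (4 ℕ.+ r ℕ.+ r)              ≡⟨ ℕ.^-distribˡ-+-* 2 (4 ℕ.+ r) r ⟩
  2 ^ (4 ℕ.+ r) ℕ.* 2 ^ r          ∎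
  where open ≡-Reasoning

-- Coefficient lists are not normalised (they may end in zeros), so polynomials are compared coefficientwise.
infix 4 _≈ₚ_

record _≈ₚ_ (p q : Poly) : Set where
  constructor coeffwise
  field coeff-≡ : ∀ k → coeff p k ≡ coeff q k
open _≈ₚ_

-ₚ_ : Poly → Poly
-ₚ p = map -_ p

1ₚ : Poly
1ₚ = mono (+ 1) 0

coeff-+ₚ : ∀ p q k → coeff (p +ₚ q) k ≡ coeff p k + coeff q k
coeff-+ₚ []      q       k       = sym (ℤ.+-identityˡ _)
coeff-+ₚ (a ∷ p) []      k       = sym (ℤ.+-identityʳ _)
coeff-+ₚ (a ∷ p) (b ∷ q) zero    = refl
coeff-+ₚ (a ∷ p) (b ∷ q) (suc k) = coeff-+ₚ p q k

coeff-·ₚ : ∀ c p k → coeff (c ·ₚ p) k ≡ c * coeff p k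
coeff-·ₚ c []      k       = sym (ℤ.*-zeroʳ c)
coeff-·ₚ c (a ∷ p) zero    = refl
coeff-·ₚ c (a ∷ p) (suc k) = coeff-·ₚ c p k

coeff--ₚ : ∀ p k → coeff (-ₚ p) k ≡ - coeff p k
coeff--ₚ []      k       = refl
coeff--ₚ (a ∷ p) zero    = refl
coeff--ₚ (a ∷ p) (suc k) = coeff--ₚ p k

≈ₚ-isEquivalence : IsEquivalence _≈ₚ_
≈ₚ-isEquivalence = record
  { refl  = coeffwise λ _ → refl
  ; sym   = λ p≈q → coeffwise λ k → sym (coeff-≡ p≈q k)
  ; trans = λ p≈q q≈r → coeffwise λ k → trans (coeff-≡ p≈q k) (coeff-≡ q≈r k)
  }

≈ₚ-setoid : Setoid _ _
≈ₚ-setoid = record { isEquivalence = ≈ₚ-isEquivalence }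

open IsEquivalence ≈ₚ-isEquivalence
  using () renaming (refl to ≈ₚ-refl; sym to ≈ₚ-sym; trans to ≈ₚ-trans; reflexive to ≡⇒≈ₚ)
open SetoidReasoning ≈ₚ-setoid

∷-cong : ∀ {a b p q} → a ≡ b → p ≈ₚ q → a ∷ p ≈ₚ b ∷ q
∷-cong a≡b p≈q = coeffwise λ { zero → a≡b ; (suc k) → coeff-≡ p≈q k }

∷-zero : ∀ {a p} → a ≡ + 0 → p ≈ₚ [] → a ∷ p ≈ₚ []
∷-zero a≡0 p≈0 = coeffwise λ { zero → a≡0 ; (suc k) → coeff-≡ p≈0 k }

+ₚ-cong : ∀ {p p′ q q′} → p ≈ₚ p′ → q ≈ₚ q′ → p +ₚ q ≈ₚ p′ +ₚ q′
+ₚ-cong {p} {p′} {q} {q′} p≈ q≈ = coeffwise λ k →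
  trans (coeff-+ₚ p q k) (trans (cong₂ _+_ (coeff-≡ p≈ k) (coeff-≡ q≈ k)) (sym (coeff-+ₚ p′ q′ k)))

+ₚ-assoc : ∀ p q r → (p +ₚ q) +ₚ r ≈ₚ p +ₚ (q +ₚ r)
+ₚ-assoc []      q       r       = ≈ₚ-refl
+ₚ-assoc (a ∷ p) []      r       = ≈ₚ-refl
+ₚ-assoc (a ∷ p) (b ∷ q) []      = ≈ₚ-refl
+ₚ-assoc (a ∷ p) (b ∷ q) (c ∷ r) = ∷-cong (ℤ.+-assoc a b c) (+ₚ-assoc p q r)

+ₚ-comm : ∀ p q → p +ₚ q ≈ₚ q +ₚ p
+ₚ-comm []      []      = ≈ₚ-refl
+ₚ-comm []      (b ∷ q) = ≈ₚ-refl
+ₚ-comm (a ∷ p) []      = ≈ₚ-refl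
+ₚ-comm (a ∷ p) (b ∷ q) = ∷-cong (ℤ.+-comm a b) (+ₚ-comm p q)

+ₚ-identityʳ : ∀ p → p +ₚ [] ≈ₚ p
+ₚ-identityʳ []      = ≈ₚ-refl
+ₚ-identityʳ (a ∷ p) = ≈ₚ-refl

-ₚ-inverseˡ : ∀ p → (-ₚ p) +ₚ p ≈ₚ []
-ₚ-inverseˡ []      = ≈ₚ-refl
-ₚ-inverseˡ (a ∷ p) = ∷-zero (ℤ.+-inverseˡ a) (-ₚ-inverseˡ p)

-ₚ-cong : ∀ {p q} → p ≈ₚ q → -ₚ p ≈ₚ -ₚ q
-ₚ-cong {p} {q} p≈q = coeffwise λ k → trans (coeff--ₚ p k) (trans (cong -_ (coeff-≡ p≈q k)) (sym (coeff--ₚ q k)))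

+ₚ-commutativeMonoid : CommutativeMonoid _ _
+ₚ-commutativeMonoid = record
  { _≈_ = _≈ₚ_ ; _∙_ = _+ₚ_ ; ε = []
  ; isCommutativeMonoid = record
    { isMonoid = record
      { isSemigroup = record
        { isMagma = record { isEquivalence = ≈ₚ-isEquivalence ; ∙-cong = +ₚ-cong }
        ; assoc = +ₚ-assoc }
      ; identity = (λ _ → ≈ₚ-refl) , +ₚ-identityʳ }
    ; comm = +ₚ-comm } }

open import Algebra.Properties.CommutativeSemigroup (CommutativeMonoid.commutativeSemigroup +ₚ-commutativeMonoid)
  using () renaming (interchange to +ₚ-interchange; x∙yz≈y∙xz to +ₚ-leftComm)

·ₚ-cong : ∀ c {p q} → p ≈ₚ q → c ·ₚ p ≈ₚ c ·ₚ q
·ₚ-cong c {p} {q} p≈q = coeffwise λ k →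
  trans (coeff-·ₚ c p k) (trans (cong (c *_) (coeff-≡ p≈q k)) (sym (coeff-·ₚ c q k)))

·ₚ-distrib-+ₚ : ∀ c p q → c ·ₚ (p +ₚ q) ≡ c ·ₚ p +ₚ c ·ₚ q
·ₚ-distrib-+ₚ c []      q       = refl
·ₚ-distrib-+ₚ c (a ∷ p) []      = refl
·ₚ-distrib-+ₚ c (a ∷ p) (b ∷ q) = cong₂ _∷_ (ℤ.*-distribˡ-+ c a b) (·ₚ-distrib-+ₚ c p q)

·ₚ-assoc : ∀ a b p → (a * b) ·ₚ p ≡ a ·ₚ (b ·ₚ p)
·ₚ-assoc a b []      = refl
·ₚ-assoc a b (c ∷ p) = cong₂ _∷_ (ℤ.*-assoc a b c) (·ₚ-assoc a b p)

·ₚ-zeroˡ : ∀ p → + 0 ·ₚ p ≈ₚ []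
·ₚ-zeroˡ []      = ≈ₚ-refl
·ₚ-zeroˡ (a ∷ p) = ∷-zero refl (·ₚ-zeroˡ p)

·ₚ-identityˡ : ∀ p → + 1 ·ₚ p ≡ p
·ₚ-identityˡ []      = refl
·ₚ-identityˡ (a ∷ p) = cong₂ _∷_ (ℤ.*-identityˡ a) (·ₚ-identityˡ p)

·ₚ-shift : ∀ c p → c ·ₚ (+ 0 ∷ p) ≈ₚ + 0 ∷ c ·ₚ p
·ₚ-shift c p = ∷-cong (ℤ.*-zeroʳ c) ≈ₚ-refl

*ₚ-zeroʳ : ∀ p → p *ₚ [] ≈ₚ []
*ₚ-zeroʳ []      = ≈ₚ-refl
*ₚ-zeroʳ (a ∷ p) = ∷-zero refl (*ₚ-zeroʳ p)

*ₚ-shiftˡ : ∀ p q → (+ 0 ∷ p) *ₚ q ≈ₚ + 0 ∷ p *ₚ q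
*ₚ-shiftˡ p q = +ₚ-cong (·ₚ-zeroˡ q) ≈ₚ-refl

*ₚ-consʳ : ∀ p b q → p *ₚ (b ∷ q) ≈ₚ b ·ₚ p +ₚ (+ 0 ∷ p *ₚ q)
*ₚ-consʳ []      b q = ≈ₚ-sym (∷-zero refl ≈ₚ-refl)
*ₚ-consʳ (a ∷ p) b q = ∷-cong (cong (_+ + 0) (ℤ.*-comm a b)) (begin
  a ·ₚ q +ₚ p *ₚ (b ∷ q)                  ≈⟨ +ₚ-cong ≈ₚ-refl (*ₚ-consʳ p b q) ⟩
  a ·ₚ q +ₚ (b ·ₚ p +ₚ (+ 0 ∷ p *ₚ q))    ≈⟨ +ₚ-leftComm (a ·ₚ q) (b ·ₚ p) _ ⟩
  b ·ₚ p +ₚ (a ·ₚ q +ₚ (+ 0 ∷ p *ₚ q))    ∎)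

*ₚ-comm : ∀ p q → p *ₚ q ≈ₚ q *ₚ p
*ₚ-comm []      q = ≈ₚ-sym (*ₚ-zeroʳ q)
*ₚ-comm (a ∷ p) q = ≈ₚ-trans (+ₚ-cong ≈ₚ-refl (∷-cong refl (*ₚ-comm p q))) (≈ₚ-sym (*ₚ-consʳ q a p))

*ₚ-congʳ : ∀ p {q q′} → q ≈ₚ q′ → p *ₚ q ≈ₚ p *ₚ q′
*ₚ-congʳ []      q≈q′ = ≈ₚ-refl
*ₚ-congʳ (a ∷ p) q≈q′ = +ₚ-cong (·ₚ-cong a q≈q′) (∷-cong refl (*ₚ-congʳ p q≈q′))

*ₚ-cong : ∀ {p p′ q q′} → p ≈ₚ p′ → q ≈ₚ q′ → p *ₚ q ≈ₚ p′ *ₚ q′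
*ₚ-cong {p} {p′} {q} {q′} p≈p′ q≈q′ = begin
  p *ₚ q    ≈⟨ *ₚ-congʳ p q≈q′ ⟩
  p *ₚ q′   ≈⟨ *ₚ-comm p q′ ⟩
  q′ *ₚ p   ≈⟨ *ₚ-congʳ q′ p≈p′ ⟩
  q′ *ₚ p′  ≈⟨ *ₚ-comm q′ p′ ⟩
  p′ *ₚ q′  ∎

*ₚ-distribˡ : ∀ p q r → p *ₚ (q +ₚ r) ≈ₚ p *ₚ q +ₚ p *ₚ r
*ₚ-distribˡ []      q r = ≈ₚ-refl
*ₚ-distribˡ (a ∷ p) q r = begin
  a ·ₚ (q +ₚ r) +ₚ (+ 0 ∷ p *ₚ (q +ₚ r))
    ≈⟨ +ₚ-cong (≡⇒≈ₚ (·ₚ-distrib-+ₚ a q r)) (∷-cong refl (*ₚ-distribˡ p q r)) ⟩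
  (a ·ₚ q +ₚ a ·ₚ r) +ₚ ((+ 0 ∷ p *ₚ q) +ₚ (+ 0 ∷ p *ₚ r)) ≈⟨ +ₚ-interchange (a ·ₚ q) (a ·ₚ r) _ _ ⟩
  (a ·ₚ q +ₚ (+ 0 ∷ p *ₚ q)) +ₚ (a ·ₚ r +ₚ (+ 0 ∷ p *ₚ r)) ∎

*ₚ-distribʳ : ∀ p q r → (q +ₚ r) *ₚ p ≈ₚ q *ₚ p +ₚ r *ₚ p
*ₚ-distribʳ p q r = begin
  (q +ₚ r) *ₚ p        ≈⟨ *ₚ-comm (q +ₚ r) p ⟩
  p *ₚ (q +ₚ r)        ≈⟨ *ₚ-distribˡ p q r ⟩
  p *ₚ q +ₚ p *ₚ r     ≈⟨ +ₚ-cong (*ₚ-comm p q) (*ₚ-comm p r) ⟩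
  q *ₚ p +ₚ r *ₚ p     ∎

·ₚ-*ₚ-assoc : ∀ c p q → (c ·ₚ p) *ₚ q ≈ₚ c ·ₚ (p *ₚ q)
·ₚ-*ₚ-assoc c []      q = ≈ₚ-refl
·ₚ-*ₚ-assoc c (a ∷ p) q = begin
  (c * a) ·ₚ q +ₚ (+ 0 ∷ (c ·ₚ p) *ₚ q)   ≈⟨ +ₚ-cong (≡⇒≈ₚ (·ₚ-assoc c a q)) (∷-cong refl (·ₚ-*ₚ-assoc c p q)) ⟩
  c ·ₚ (a ·ₚ q) +ₚ (+ 0 ∷ c ·ₚ (p *ₚ q))    ≈⟨ +ₚ-cong ≈ₚ-refl (≈ₚ-sym (·ₚ-shift c (p *ₚ q))) ⟩
  c ·ₚ (a ·ₚ q) +ₚ c ·ₚ (+ 0 ∷ p *ₚ q)      ≡⟨ sym (·ₚ-distrib-+ₚ c (a ·ₚ q) _) ⟩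
  c ·ₚ (a ·ₚ q +ₚ (+ 0 ∷ p *ₚ q))           ∎

*ₚ-assoc : ∀ p q r → (p *ₚ q) *ₚ r ≈ₚ p *ₚ (q *ₚ r)
*ₚ-assoc []      q r = ≈ₚ-refl
*ₚ-assoc (a ∷ p) q r = begin
  (a ·ₚ q +ₚ (+ 0 ∷ p *ₚ q)) *ₚ r           ≈⟨ *ₚ-distribʳ r (a ·ₚ q) _ ⟩
  (a ·ₚ q) *ₚ r +ₚ (+ 0 ∷ p *ₚ q) *ₚ r      ≈⟨ +ₚ-cong (·ₚ-*ₚ-assoc a q r) (*ₚ-shiftˡ (p *ₚ q) r) ⟩
  a ·ₚ (q *ₚ r) +ₚ (+ 0 ∷ (p *ₚ q) *ₚ r)    ≈⟨ +ₚ-cong ≈ₚ-refl (∷-cong refl (*ₚ-assoc p q r)) ⟩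
  a ·ₚ (q *ₚ r) +ₚ (+ 0 ∷ p *ₚ (q *ₚ r))    ∎

const-*ₚ : ∀ c p → (c ∷ []) *ₚ p ≈ₚ c ·ₚ p
const-*ₚ c p = ≈ₚ-trans (+ₚ-cong ≈ₚ-refl (∷-zero refl ≈ₚ-refl)) (+ₚ-identityʳ (c ·ₚ p))

*ₚ-identityˡ : ∀ p → 1ₚ *ₚ p ≈ₚ p
*ₚ-identityˡ p = ≈ₚ-trans (const-*ₚ (+ 1) p) (≡⇒≈ₚ (·ₚ-identityˡ p))

Poly-commutativeRing : CommutativeRing _ _
Poly-commutativeRing = record
  { Carrier = Poly ; _≈_ = _≈ₚ_ ; _+_ = _+ₚ_ ; _*_ = _*ₚ_ ; -_ = -ₚ_ ; 0# = [] ; 1# = 1ₚ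
  ; isCommutativeRing = record
    { isRing = record
      { +-isAbelianGroup = record
        { isGroup = record
          { isMonoid = CommutativeMonoid.isMonoid +ₚ-commutativeMonoid
          ; inverse = -ₚ-inverseˡ , λ p → ≈ₚ-trans (+ₚ-comm p (-ₚ p)) (-ₚ-inverseˡ p)
          ; ⁻¹-cong = -ₚ-cong }
        ; comm = +ₚ-comm }
      ; *-cong = *ₚ-cong
      ; *-assoc = *ₚ-assoc
      ; *-identity = *ₚ-identityˡ , λ p → ≈ₚ-trans (*ₚ-comm p 1ₚ) (*ₚ-identityˡ p)
      ; distrib = *ₚ-distribˡ , *ₚ-distribʳ }
    ; *-comm = *ₚ-comm } }

open RingCongruence Poly-commutativeRing

constₚ : ℕ → Poly
constₚ n = + n ∷ []

x-1 : Poly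
x-1 = -1ℤ ∷ 1ℤ ∷ []

constₚ-* : ∀ m n → constₚ (m ℕ.* n) ≈ₚ constₚ m *ₚ constₚ n
constₚ-* m n = ≈ₚ-sym (≈ₚ-trans (const-*ₚ (+ m) (constₚ n)) (∷-cong (sym (ℤ.pos-* m n)) ≈ₚ-refl))

constₚ-2^suc : ∀ n → constₚ (2 ^ suc n) ≈ₚ two *ₚ constₚ (2 ^ n)
constₚ-2^suc n = constₚ-* 2 (2 ^ n)

linFactor-shiftᵢ : ∀ j n i → linFactor j (n ℕ.+ i) ≈ₚ linFactor j i +ₚ constₚ n *ₚ x-1
linFactor-shiftᵢ j n i = ∷-cong constant (∷-cong linear ≈ₚ-refl)
  where
  constant : j - + (n ℕ.+ i) ≡ (j - + i) + (+ n * -1ℤ + + 0)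
  constant = trans (cong (λ k → j - k) (ℤ.pos-+ n i)) (shuffle j (+ n) (+ i))
    where
    shuffle : ∀ j n i → j - (n + i) ≡ (j - i) + (n * -1ℤ + + 0)
    shuffle = solve-∀
  linear : + (n ℕ.+ i) ≡ + i + + n * 1ℤ
  linear = trans (ℤ.pos-+ n i) (shuffle (+ n) (+ i))
    where
    shuffle : ∀ n i → n + i ≡ i + n * 1ℤ
    shuffle = solve-∀

linFactor-shiftᵢ-even : ∀ j m i → linFactor j (2 ^ suc m ℕ.+ i) ≈ₚ linFactor j i +ₚ two *ₚ (constₚ (2 ^ m) *ₚ x-1)
linFactor-shiftᵢ-even j m i = begin
  linFactor j (2 ^ suc m ℕ.+ i)       ≈⟨ linFactor-shiftᵢ j (2 ^ suc m) i ⟩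
  L +ₚ constₚ (2 ^ suc m) *ₚ x-1      ≈⟨ +ₚ-cong (≈ₚ-refl {L}) (*ₚ-cong (constₚ-2^suc m) (≈ₚ-refl {x-1})) ⟩
  L +ₚ two *ₚ constₚ (2 ^ m) *ₚ x-1   ≈⟨ +ₚ-cong (≈ₚ-refl {L}) (*ₚ-assoc two (constₚ (2 ^ m)) x-1) ⟩
  L +ₚ two *ₚ (constₚ (2 ^ m) *ₚ x-1) ∎
  where L = linFactor j i

linFactor-shiftⱼ : ∀ j t i → linFactor (j + t * + 2) i ≈ₚ linFactor j i +ₚ two *ₚ (t ∷ [])
linFactor-shiftⱼ j t i = ∷-cong (shuffle j t (+ i)) ≈ₚ-refl
  where
  shuffle : ∀ j t i → j + t * + 2 - i ≡ (j - i) + (+ 2 * t + + 0)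
  shuffle = solve-∀

mono-+ : ∀ m n → mono (+ 1) (m ℕ.+ n) ≈ₚ mono (+ 1) m *ₚ mono (+ 1) n
mono-+ zero    n = ≈ₚ-sym (*ₚ-identityˡ (mono (+ 1) n))
mono-+ (suc m) n = ≈ₚ-trans (∷-cong refl (mono-+ m n)) (≈ₚ-sym (*ₚ-shiftˡ (mono (+ 1) m) (mono (+ 1) n)))

upperFactors : ℤ → ℕ → List Poly
upperFactors j m = map (linFactor j ∘ (2 ^ m ℕ.+_)) (upTo (2 ^ m))

lhsPoly-halves : ∀ j m → lhsPoly j (suc m) ≈ₚ lhsPoly j m *ₚ product (upperFactors j m)
lhsPoly-halves j m = ≈ₚ-trans (≡⇒≈ₚ (cong product (map-upTo-2^suc (linFactor j) m)))
                              (product-++ (map (linFactor j) (upTo (2 ^ m))) (upperFactors j m))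

∂lhsPoly-even : ∀ j m → ∂product (map (linFactor j) (upTo (2 ^ suc (suc m)))) ≈ [] mod two
∂lhsPoly-even j m = subst (λ fs → ∂product fs ≈ [] mod two) (sym (map-upTo-2^suc (linFactor j) (suc m)))
  (∂product-doubled (linFactor j) (linFactor j ∘ (2 ^ suc m ℕ.+_))
    (λ i → witness (constₚ (2 ^ m) *ₚ x-1) (linFactor-shiftᵢ-even j m i)) (upTo (2 ^ suc m)))

lhsPoly-suc≈square : ∀ j m →
  lhsPoly j (3 ℕ.+ m) ≈ lhsPoly j (2 ℕ.+ m) *ₚ lhsPoly j (2 ℕ.+ m) mod constₚ (2 ^ (3 ℕ.+ m))
lhsPoly-suc≈square j m =
  ≈-mod-trans (≈⇒≈-mod (lhsPoly-halves j (2 ℕ.+ m))) (*-congˡ-mod (lhsPoly j (2 ℕ.+ m)) upper≈lower)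
  where
  C = constₚ (2 ^ suc m)
  upper≈lower : product (upperFactors j (2 ℕ.+ m)) ≈ lhsPoly j (2 ℕ.+ m) mod constₚ (2 ^ (3 ℕ.+ m))
  upper≈lower =
    mod-resp (≈ₚ-trans (≈ₚ-sym (constₚ-* 4 (2 ^ suc m))) (≡⇒≈ₚ (cong constₚ (ℕ.*-assoc 2 2 (2 ^ suc m)))))
    (mod-*ʳ x-1 (mod-resp (≈ₚ-sym (*ₚ-assoc (two *ₚ two) C x-1))
      (product-even-shift (linFactor j) (linFactor j ∘ (2 ^ (2 ℕ.+ m) ℕ.+_)) (C *ₚ x-1)
        (linFactor-shiftᵢ-even j (suc m)) (upTo (2 ^ (2 ℕ.+ m))) (∂lhsPoly-even j m))))

x⁴+x³+x+1 : Poly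
x⁴+x³+x+1 = mono (+ 1) 4 +ₚ mono (+ 1) 3 +ₚ mono (+ 1) 1 +ₚ mono (+ 1) 0

rhsPoly-suc : ∀ q → rhsPoly (suc q) ≈ₚ mono (+ 1) (2 ^ q ∸ 2) *ₚ (constₚ (2 ^ q) *ₚ x⁴+x³+x+1 +ₚ mono (+ 1) 2)
rhsPoly-suc q = *ₚ-congʳ (mono (+ 1) (2 ^ q ∸ 2))
  (+ₚ-cong (≈ₚ-sym (const-*ₚ (+ (2 ^ q)) x⁴+x³+x+1)) (≈ₚ-refl {mono (+ 1) 2}))

mono-2*n∸2 : ∀ n → 2 ≤ n → mono (+ 1) (2 ℕ.* n ∸ 2) ≈ₚ mono (+ 1) (n ∸ 2) *ₚ (mono (+ 1) (n ∸ 2) *ₚ mono (+ 1) 2)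
mono-2*n∸2 n 2≤n = begin
  mono (+ 1) (2 ℕ.* n ∸ 2)                            ≡⟨ cong (mono (+ 1)) (2*n∸2 n 2≤n) ⟩
  mono (+ 1) ((n ∸ 2) ℕ.+ ((n ∸ 2) ℕ.+ 2))            ≈⟨ mono-+ (n ∸ 2) _ ⟩
  mono (+ 1) (n ∸ 2) *ₚ mono (+ 1) ((n ∸ 2) ℕ.+ 2)    ≈⟨ *ₚ-congʳ (mono (+ 1) (n ∸ 2)) (mono-+ (n ∸ 2) 2) ⟩
  mono (+ 1) (n ∸ 2) *ₚ (mono (+ 1) (n ∸ 2) *ₚ mono (+ 1) 2) ∎

-- With h = 2^{q-1}, the error term R_q² − R_{q+1} is h² x^{2h−4} (x⁴+x³+x+1)², and 2^{q+1} divides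
-- h² = 2^{2q−2} only because q ≥ 3.
rhsPoly-square≈suc : ∀ r → rhsPoly (3 ℕ.+ r) *ₚ rhsPoly (3 ℕ.+ r) ≈ rhsPoly (4 ℕ.+ r) mod constₚ (2 ^ (4 ℕ.+ r))
rhsPoly-square≈suc r = mod-*ʳ (constₚ (2 ^ r)) (mod-resp modulus (witness (A *ₚ A *ₚ T *ₚ T) (begin
  rhsPoly (3 ℕ.+ r) *ₚ rhsPoly (3 ℕ.+ r)               ≈⟨ *ₚ-cong (rhsPoly-suc (2 ℕ.+ r)) (rhsPoly-suc (2 ℕ.+ r)) ⟩
  (A *ₚ (H *ₚ T +ₚ S)) *ₚ (A *ₚ (H *ₚ T +ₚ S))         ≈⟨ expand A H T S ⟩
  A *ₚ (A *ₚ S) *ₚ (two *ₚ H *ₚ T +ₚ S) +ₚ H *ₚ H *ₚ (A *ₚ A *ₚ T *ₚ T)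
                                                       ≈⟨ +ₚ-cong (≈ₚ-sym R₄≈) ≈ₚ-refl ⟩
  rhsPoly (4 ℕ.+ r) +ₚ H *ₚ H *ₚ (A *ₚ A *ₚ T *ₚ T)    ∎)))
  where
  h = 2 ^ (2 ℕ.+ r)
  A = mono (+ 1) (h ∸ 2)
  H = constₚ h
  S = mono (+ 1) 2
  T = x⁴+x³+x+1
  open import Algebra.Solver.Ring.NaturalCoefficients.Default (CommutativeRing.commutativeSemiring Poly-commutativeRing)
  expand : ∀ A H T S → (A *ₚ (H *ₚ T +ₚ S)) *ₚ (A *ₚ (H *ₚ T +ₚ S))
                       ≈ₚ A *ₚ (A *ₚ S) *ₚ (two *ₚ H *ₚ T +ₚ S) +ₚ H *ₚ H *ₚ (A *ₚ A *ₚ T *ₚ T)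
  expand = solve 4 (λ A H T S → (A :* (H :* T :+ S)) :* (A :* (H :* T :+ S))
                             := A :* (A :* S) :* (con 2 :* H :* T :+ S) :+ H :* H :* (A :* A :* T :* T)) ≈ₚ-refl
  R₄≈ : rhsPoly (4 ℕ.+ r) ≈ₚ A *ₚ (A *ₚ S) *ₚ (two *ₚ H *ₚ T +ₚ S)
  R₄≈ = ≈ₚ-trans (rhsPoly-suc (3 ℕ.+ r))
    (*ₚ-cong (mono-2*n∸2 h (ℕ.^-monoʳ-≤ 2 {1} {2 ℕ.+ r} (s≤s z≤n)))
             (+ₚ-cong (*ₚ-cong (constₚ-* 2 h) (≈ₚ-refl {T})) (≈ₚ-refl {S})))
  modulus : H *ₚ H ≈ₚ constₚ (2 ^ (4 ℕ.+ r)) *ₚ constₚ (2 ^ r)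
  modulus = begin
    H *ₚ H                                    ≈⟨ constₚ-* h h ⟨
    constₚ (h ℕ.* h)                          ≡⟨ cong constₚ (2^[2+r]² r) ⟩
    constₚ (2 ^ (4 ℕ.+ r) ℕ.* 2 ^ r)          ≈⟨ constₚ-* (2 ^ (4 ℕ.+ r)) (2 ^ r) ⟩
    constₚ (2 ^ (4 ℕ.+ r)) *ₚ constₚ (2 ^ r)  ∎

square-mod-2^ : ∀ {a b} n → a ≈ b mod constₚ (2 ^ suc n) → a *ₚ a ≈ b *ₚ b mod constₚ (2 ^ suc (suc n))
square-mod-2^ n a≈b = mod-resp (≈ₚ-sym (≈ₚ-trans (constₚ-2^suc (suc n)) (*ₚ-congʳ two (constₚ-2^suc n))))
                               (square-mod (constₚ (2 ^ n)) (mod-resp (constₚ-2^suc n) a≈b))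

lhsPoly-odd≈lhsPoly-1 : ∀ t → lhsPoly (1ℤ + t * + 2) 2 ≈ lhsPoly 1ℤ 2 mod constₚ 4
lhsPoly-odd≈lhsPoly-1 t = mod-*ʳ (t ∷ [])
  (product-even-shift (linFactor 1ℤ) (linFactor (1ℤ + t * + 2)) (t ∷ [])
    (linFactor-shiftⱼ 1ℤ t) (upTo 4) (∂lhsPoly-even 1ℤ 0))

-- lhsPoly 1ℤ 2 = x (2x − 1) (3x − 2), whose square is rhsPoly 3 + 8 (4x⁶ − 11x⁵ + 9x⁴ − 4x³).
lhsPoly-1-square : lhsPoly 1ℤ 2 *ₚ lhsPoly 1ℤ 2 ≈ rhsPoly 3 mod constₚ 8
lhsPoly-1-square = witness (+ 0 ∷ + 0 ∷ + 0 ∷ -[1+ 3 ] ∷ + 9 ∷ -[1+ 10 ] ∷ + 4 ∷ []) (coeffwise λ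
  { 0 → refl ; 1 → refl ; 2 → refl ; 3 → refl ; 4 → refl ; 5 → refl ; 6 → refl ; 7 → refl ; 8 → refl
  ; (suc (suc (suc (suc (suc (suc (suc (suc (suc k))))))))) → refl })

lhsPoly≈rhsPoly-3 : ∀ t → lhsPoly (1ℤ + t * + 2) 3 ≈ rhsPoly 3 mod constₚ 8
lhsPoly≈rhsPoly-3 t = ≈-mod-trans (lhsPoly-suc≈square (1ℤ + t * + 2) 0)
                     (≈-mod-trans (square-mod-2^ 1 (lhsPoly-odd≈lhsPoly-1 t)) lhsPoly-1-square)

lhsPoly≈rhsPoly : ∀ t r → lhsPoly (1ℤ + t * + 2) (3 ℕ.+ r) ≈ rhsPoly (3 ℕ.+ r) mod constₚ (2 ^ (3 ℕ.+ r))
lhsPoly≈rhsPoly t zero    = lhsPoly≈rhsPoly-3 t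
lhsPoly≈rhsPoly t (suc r) = ≈-mod-trans (lhsPoly-suc≈square (1ℤ + t * + 2) (suc r))
  (≈-mod-trans (square-mod-2^ (2 ℕ.+ r) (lhsPoly≈rhsPoly t r)) (rhsPoly-square≈suc r))

≈-mod⇒≡ₚ-mod : ∀ {a b} n → a ≈ b mod constₚ n → a ≡ₚ b mod n
≈-mod⇒≡ₚ-mod {a} {b} n (witness s a≈b+ns) k =
  ∣⇒∣ᵤ (divides (coeff s k) (trans (cong (_- coeff b k) coeff-a) (cancel (coeff b k) (+ n) (coeff s k))))
  where
  coeff-a : coeff a k ≡ coeff b k + + n * coeff s k
  coeff-a = trans (coeff-≡ a≈b+ns k) (trans (coeff-+ₚ b (constₚ n *ₚ s) k)
                  (cong (λ z → coeff b k + z) (trans (coeff-≡ (const-*ₚ (+ n) s) k) (coeff-·ₚ (+ n) s k))))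
  cancel : ∀ b n s → b + n * s - b ≡ s * n
  cancel = solve-∀

odd⇒1+2t : ∀ j → ¬ (+ 2 ∣ j) → ∃ λ t → j ≡ 1ℤ + t * + 2
odd⇒1+2t j 2∤j with j ℤ.%ℕ 2 | ℤ.a≡a%ℕn+[a/ℕn]*n j 2 | ℤ.n%ℕd<d j 2
... | 0           | j≡0+2t | _            = ⊥-elim (2∤j (∣⇒∣ᵤ (divides (j ℤ./ℕ 2) (trans j≡0+2t (ℤ.+-identityˡ _)))))
... | 1           | j≡1+2t | _            = j ℤ./ℕ 2 , j≡1+2t
... | suc (suc _) | _      | s≤s (s≤s ())

mainTheorem14 : (j : ℤ) → ¬ ((+ 2) ∣ j) → (q : ℕ) → 3 ≤ q →
    lhsPoly j q ≡ₚ rhsPoly q mod (2 ^ q)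
mainTheorem14 j 2∤j (suc (suc (suc r))) (s≤s (s≤s (s≤s _))) with odd⇒1+2t j 2∤j
... | t , refl = ≈-mod⇒≡ₚ-mod (2 ^ (3 ℕ.+ r)) (lhsPoly≈rhsPoly t r)
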